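{- Let $G=(V,E)$ be a graph with maximum degree $\Delta$ and let $\mathcal{P}$ be a partition of $V$ such that for each $U\in\mathcal{P}$, $G[U]$ is connected and $|U|\le s$. Let $G_{\mathcal{P}}$ be the multigraph obtained from $G$ by contracting each set $U\in\mathcal{P}$ into a single node. If $h(G)\le\frac{1}{2s}$, then $h(G_{\mathcal{P}})\le 4s^2\Delta\, h(G)$.
   Context: The expansion of a graph $H=(V,E)$ is $h(H)=\min_{\emptyset\ne S\subsetneq V}\frac{\delta(S)}{\min\{|S|,|V\setminus S|\}}$, where $\delta(S)$ is the number of edges with exactly one endpoint in $S$. In the contraction, parallel edges are kept. -}

module Defs where

open import Data.Nat as ℕ using (ℕ; zero; suc; _≤_; _<_; _<?_; _⊔_)
open import Data.Integer using (+_)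
open import Data.Rational as ℚ using (ℚ; _/_)
open import Data.Bool using (Bool; true; false; if_then_else_; _∧_; not)
open import Data.Fin using (Fin)
open import Data.Fin.Subset using (Subset; ∣_∣; ∁)
open import Data.Vec using (Vec; []; _∷_; lookup)
open import Data.List using (List; []; _∷_; map; filter; allFin; foldr; _++_)
open import Data.Nat.ListAction using (sum)
open import Data.Fin.Properties using (_≟_)
open import Relation.Nullary using (does)
open import Data.Product using (_×_; Σ)
open import Relation.Binary.PropositionalEquality using (_≡_)
open import Relation.Nullary.Decidable using (_×-dec_)

Σ[_]_ : (n : ℕ) → (Fin n → ℕ) → ℕ
Σ[ n ] f = sum (map f (allFin n))

count : (n : ℕ) → (Fin n → Bool) → ℕ
count n P = Σ[ n ] (λ u → if P u then 1 else 0)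

-- Multigraphs on vertex set Fin m, given by edge multiplicities
-- w u v (w u v = w v u).  A simple graph is the 0/1 case.

Multigraph : ℕ → Set
Multigraph m = Fin m → Fin m → ℕ

δ : {m : ℕ} → Multigraph m → Subset m → ℕ
δ {m} w S = Σ[ m ] (λ u → Σ[ m ] (λ v →
  if lookup S u ∧ not (lookup S v) then w u v else 0))

subsets : (m : ℕ) → List (Subset m)
subsets zero = [] ∷ []
subsets (suc m) = map (true ∷_) (subsets m) ++ map (false ∷_) (subsets m)

properSubsets : (m : ℕ) → List (Subset m)
properSubsets m = filter (λ S → (0 <? ∣ S ∣) ×-dec (∣ S ∣ <? m)) (subsets m)

-- a / k as a rational (k = 0 never occurs where this is used)
_÷ℕ_ : ℕ → ℕ → ℚ
a ÷ℕ zero = ℚ.0ℚ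
a ÷ℕ suc k = + a / suc k

-- minimum of a list of rationals (the empty case never occurs where used)
minimum : List ℚ → ℚ
minimum [] = ℚ.0ℚ
minimum (x ∷ []) = x
minimum (x ∷ y ∷ xs) = x ℚ.⊓ minimum (y ∷ xs)

expansion : {m : ℕ} → Multigraph m → ℚ
expansion {m} w =
  minimum (map (λ S → δ w S ÷ℕ (∣ S ∣ ℕ.⊓ ∣ ∁ S ∣)) (properSubsets m))

record Graph (n : ℕ) : Set where
  field
    adj   : Fin n → Fin n → Bool
    sym   : ∀ u v → adj u v ≡ adj v u
    irrefl : ∀ u → adj u u ≡ false
open Graph public

asMultigraph : {n : ℕ} → Graph n → Multigraph n
asMultigraph G u v = if adj G u v then 1 else 0

degree : {n : ℕ} → Graph n → Fin n → ℕ
degree {n} G v = count n (adj G v)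

maxDegree : {n : ℕ} → Graph n → ℕ
maxDegree {n} G = foldr _⊔_ 0 (map (degree G) (allFin n))

-- walks in G all of whose vertices lie in U (i.e. walks in G[U])
data WalkIn {n : ℕ} (G : Graph n) (U : Fin n → Set) : Fin n → Fin n → Set where
  here : ∀ {u} → U u → WalkIn G U u u
  step : ∀ {u v w} → U u → adj G u v ≡ true → WalkIn G U v w → WalkIn G U u w

InducedConnected : {n : ℕ} → Graph n → (Fin n → Set) → Set
InducedConnected G U = ∀ u v → U u → U v → WalkIn G U u v

-- Partitions of Fin n into m (nonempty) parts, given by p : Fin n → Fin m;
-- part a is U_a = { u | p u ≡ a }.

Surjective : {n m : ℕ} → (Fin n → Fin m) → Set
Surjective {n} {m} p = ∀ (a : Fin m) → Σ (Fin n) (λ u → p u ≡ a)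

partSize : {n m : ℕ} → (Fin n → Fin m) → Fin m → ℕ
partSize {n} p a = count n (λ u → does (p u ≟ a))

-- contracted multigraph G_P: multiplicity between parts a and b is the
-- number of (ordered) pairs (u,v) with u~v, u ∈ U_a, v ∈ U_b.  For a ≠ b
-- this is the number of edges of G between U_a and U_b (parallel edges
-- kept); for a = b it records loops, which never affect δ.
contract : {n m : ℕ} → Graph n → (Fin n → Fin m) → Multigraph m
contract {n} G p a b = Σ[ n ] (λ u → Σ[ n ] (λ v →
  if adj G u v ∧ does (p u ≟ a) ∧ does (p v ≟ b) then 1 else 0))

module Submission where

-- Let S be a cut of G attaining h(G), with k = min(|S|, |V ∖ S|) and δ = δ(S), so that
-- 2sδ ≤ k. Let T be the set of parts lying inside S and W their union. A vertex of S ∖ W lies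
-- in a part that also meets V ∖ S; that part induces a connected subgraph, so it contains an
-- edge of the cut, and as parts have at most s vertices, |S ∖ W| ≤ sδ. Hence |S| ≤ s|T| + sδ
-- and |V ∖ S| ≤ s|Tᶜ|, which with 2sδ ≤ k give k ≤ 2s·min(|T|, |Tᶜ|). The edges of G_P
-- leaving T are the edges of G leaving W; each of them leaves S or ends in S ∖ W, so
-- δ_P(T) ≤ δ + Δ|S ∖ W| ≤ 2sΔδ. Thus h(G_P) ≤ δ_P(T) / min(|T|, |Tᶜ|) ≤ 4s²Δδ/k = 4s²Δ h(G).

open import Defs hiding (sym)
open import Data.Nat.Properties hiding (_≟_)
open import Algebra.Properties.Semiring.Sum +-*-semiring
  using ( sum-syntax; sum-cong-≗; sum-replicate-zero; ∑-distrib-+; ∑-comm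
        ; *-distribˡ-sum; *-distribʳ-sum)
open import Data.Bool using (Bool; true; false; if_then_else_; _∧_; _∨_; not)
open import Data.Bool.Properties using (if-∧; if-eta; ∧-identityʳ; ∧-zeroʳ; ∧-distribˡ-∨; ∧-conicalˡ)
  renaming (_≟_ to _≟ᵇ_)
open import Data.Fin using (Fin; zero; suc)
open import Data.Fin.Properties using (_≟_; any?)
open import Data.List using ([]; _∷_; tabulate; allFin; map; foldr)
open import Data.List.Membership.Propositional using (_∈_)
open import Data.List.Membership.Propositional.Properties
  using (∈-map⁺; ∈-map⁻; ∈-allFin; ∈-filter⁺; ∈-filter⁻; ∈-++⁺ˡ; ∈-++⁺ʳ)
open import Data.List.Relation.Unary.Any using (here; there)
open import Data.Fin.Subset using (Subset; ∣_∣; ∁; ⁅_⁆)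
open import Data.Fin.Subset.Properties using (∣∁p∣≡n∸∣p∣; ∣p∣≤n)
open import Data.Vec using (lookup; []; _∷_)
open import Data.Vec.Properties using (lookup-map; lookup∘tabulate)
import Data.Vec as Vec
open import Data.List.Properties using (map-tabulate; map-cong)
import Data.Nat.ListAction as List
open import Data.Nat
  using ( ℕ; zero; suc; pred; _+_; _*_; _∸_; _^_; _≤_; _<_; z≤n; s≤s; _⊔_; _⊓_
        ; NonZero; >-nonZero; >-nonZero⁻¹)
import Data.Integer as ℤ
import Data.Integer.Properties as ℤₚ
open import Data.Rational using (ℚ; _/_; toℚᵘ) renaming (_≤_ to _≤ℚ_; _*_ to _*ℚ_)
import Data.Rational.Properties as ℚₚ
open import Data.Rational.Unnormalised as ℚᵘ using (mkℚᵘ; *≤*; *≡*) renaming (_≃_ to _≃ᵘ_)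
import Data.Rational.Unnormalised.Properties as ℚᵘₚ
open import Data.Sum using ([_,_]′)
open import Function.Bundles using (_⇔_; mk⇔; Equivalence)
open import Data.Product using (∃-syntax; _,_; _×_)
open import Function using (id; _∘_)
open import Data.Nat.Tactic.RingSolver using (solve-∀)
open import Relation.Nullary using (does; yes; no; Dec; contradiction)
open import Relation.Nullary.Decidable using (_×-dec_; dec-true)
open import Relation.Binary.PropositionalEquality

-- Finite sums

⟦_⟧ : Bool → ℕ
⟦ b ⟧ = if b then 1 else 0

module _ {n : ℕ} where

  Σ≡∑ : (f : Fin n → ℕ) → Σ[ n ] f ≡ ∑[ i < n ] f i
  Σ≡∑ f = trans (cong List.sum (map-tabulate id f)) (sum-tabulate f)
    where
    sum-tabulate : ∀ {n} (f : Fin n → ℕ) → List.sum (tabulate f) ≡ ∑[ i < n ] f i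
    sum-tabulate {zero}  f = refl
    sum-tabulate {suc n} f = cong (f zero +_) (sum-tabulate (f ∘ suc))

  Σ-cong : {f g : Fin n → ℕ} → (∀ i → f i ≡ g i) → Σ[ n ] f ≡ Σ[ n ] g
  Σ-cong f≗g = cong List.sum (map-cong f≗g (allFin n))

  Σ-zero : Σ[ n ] (λ _ → 0) ≡ 0
  Σ-zero = trans (Σ≡∑ _) (sum-replicate-zero n)

  Σ-distrib-+ : (f g : Fin n → ℕ) → Σ[ n ] (λ i → f i + g i) ≡ Σ[ n ] f + Σ[ n ] g
  Σ-distrib-+ f g = trans (Σ≡∑ _) (trans (∑-distrib-+ f g) (sym (cong₂ _+_ (Σ≡∑ f) (Σ≡∑ g))))

  *-distribˡ-Σ : ∀ c (f : Fin n → ℕ) → c * Σ[ n ] f ≡ Σ[ n ] (λ i → c * f i)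
  *-distribˡ-Σ c f = trans (cong (c *_) (Σ≡∑ f)) (trans (*-distribˡ-sum c f) (sym (Σ≡∑ _)))

  *-distribʳ-Σ : ∀ c (f : Fin n → ℕ) → Σ[ n ] f * c ≡ Σ[ n ] (λ i → f i * c)
  *-distribʳ-Σ c f = trans (cong (_* c) (Σ≡∑ f)) (trans (*-distribʳ-sum c f) (sym (Σ≡∑ _)))

  Σ-mono-≤ : {f g : Fin n → ℕ} → (∀ i → f i ≤ g i) → Σ[ n ] f ≤ Σ[ n ] g
  Σ-mono-≤ {f} {g} f≤g = subst₂ _≤_ (sym (Σ≡∑ f)) (sym (Σ≡∑ g)) (∑-mono f≤g)
    where
    ∑-mono : ∀ {n} {f g : Fin n → ℕ} → (∀ i → f i ≤ g i) → ∑[ i < n ] f i ≤ ∑[ i < n ] g i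
    ∑-mono {zero}  _   = z≤n
    ∑-mono {suc n} f≤g = +-mono-≤ (f≤g zero) (∑-mono (f≤g ∘ suc))

  term≤Σ : (f : Fin n → ℕ) (i : Fin n) → f i ≤ Σ[ n ] f
  term≤Σ f i = subst (f i ≤_) (sym (Σ≡∑ f)) (term≤∑ f i)
    where
    term≤∑ : ∀ {n} (f : Fin n → ℕ) (i : Fin n) → f i ≤ ∑[ j < n ] f j
    term≤∑ f zero    = m≤m+n _ _
    term≤∑ f (suc i) = ≤-trans (term≤∑ (f ∘ suc) i) (m≤n+m _ _)

  Σ-positive : (f : Fin n → ℕ) → 0 < Σ[ n ] f → ∃[ i ] 0 < f i
  Σ-positive f = ∑-positive f ∘ subst (0 <_) (Σ≡∑ f)
    where
    ∑-positive : ∀ {n} (f : Fin n → ℕ) → 0 < ∑[ i < n ] f i → ∃[ i ] 0 < f i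
    ∑-positive {suc n} f 0<∑ with f zero in eq
    ... | suc _ = zero , subst (0 <_) (sym eq) (s≤s z≤n)
    ... | zero with ∑-positive (f ∘ suc) 0<∑
    ...   | i , 0<fi = suc i , 0<fi

  if-then-Σ : ∀ b (f : Fin n → ℕ) →
              (if b then Σ[ n ] f else 0) ≡ Σ[ n ] (λ i → if b then f i else 0)
  if-then-Σ true  f = refl
  if-then-Σ false f = sym Σ-zero

Σ-comm : ∀ {m n} (f : Fin m → Fin n → ℕ) →
         Σ[ m ] (λ i → Σ[ n ] (f i)) ≡ Σ[ n ] (λ j → Σ[ m ] (λ i → f i j))
Σ-comm {m} {n} f = begin
  Σ[ m ] (λ i → Σ[ n ] (f i))          ≡⟨ Σ≡∑ (λ i → Σ[ n ] (f i)) ⟩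
  ∑[ i < m ] Σ[ n ] (f i)              ≡⟨ sum-cong-≗ (λ i → Σ≡∑ (f i)) ⟩
  ∑[ i < m ] ∑[ j < n ] f i j          ≡⟨ ∑-comm f ⟩
  ∑[ j < n ] ∑[ i < m ] f i j          ≡⟨ sum-cong-≗ (λ j → Σ≡∑ (λ i → f i j)) ⟨
  ∑[ j < n ] Σ[ m ] (λ i → f i j)      ≡⟨ Σ≡∑ (λ j → Σ[ m ] (λ i → f i j)) ⟨
  Σ[ n ] (λ j → Σ[ m ] (λ i → f i j)) ∎
  where open ≡-Reasoning

Σ²-comm : ∀ {m n} (f : Fin m → Fin m → Fin n → Fin n → ℕ) →
          Σ[ m ] (λ a → Σ[ m ] (λ b → Σ[ n ] (λ u → Σ[ n ] (f a b u)))) ≡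
          Σ[ n ] (λ u → Σ[ n ] (λ v → Σ[ m ] (λ a → Σ[ m ] (λ b → f a b u v))))
Σ²-comm {m} {n} f = begin
  Σ[ m ] (λ a → Σ[ m ] (λ b → Σ[ n ] (λ u → Σ[ n ] (f a b u))))
    ≡⟨ Σ-cong (λ a → Σ-comm (λ b u → Σ[ n ] (f a b u))) ⟩
  Σ[ m ] (λ a → Σ[ n ] (λ u → Σ[ m ] (λ b → Σ[ n ] (f a b u))))
    ≡⟨ Σ-comm (λ a u → Σ[ m ] (λ b → Σ[ n ] (f a b u))) ⟩
  Σ[ n ] (λ u → Σ[ m ] (λ a → Σ[ m ] (λ b → Σ[ n ] (f a b u))))
    ≡⟨ Σ-cong (λ u → Σ-cong (λ a → Σ-comm (λ b v → f a b u v))) ⟩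
  Σ[ n ] (λ u → Σ[ m ] (λ a → Σ[ n ] (λ v → Σ[ m ] (λ b → f a b u v))))
    ≡⟨ Σ-cong (λ u → Σ-comm (λ a v → Σ[ m ] (λ b → f a b u v))) ⟩
  Σ[ n ] (λ u → Σ[ n ] (λ v → Σ[ m ] (λ a → Σ[ m ] (λ b → f a b u v)))) ∎
  where open ≡-Reasoning

Σ-select : ∀ {m} (x : Fin m) (g : Fin m → ℕ) →
           Σ[ m ] (λ a → if does (x ≟ a) then g a else 0) ≡ g x
Σ-select x g = trans (Σ≡∑ (λ a → if does (x ≟ a) then g a else 0)) (∑-select x g)
  where
  ∑-select : ∀ {m} (x : Fin m) (g : Fin m → ℕ) →
             ∑[ a < m ] (if does (x ≟ a) then g a else 0) ≡ g x
  ∑-select {suc m} zero    g = trans (cong (g zero +_) (sum-replicate-zero m)) (+-identityʳ _)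
  ∑-select {suc m} (suc x) g = ∑-select x (g ∘ suc)

Σ-fibres : ∀ {n m} (p : Fin n → Fin m) (g : Fin n → ℕ) →
           Σ[ m ] (λ a → Σ[ n ] (λ u → if does (p u ≟ a) then g u else 0)) ≡ Σ[ n ] g
Σ-fibres p g = trans (Σ-comm (λ a u → if does (p u ≟ a) then g u else 0))
                     (Σ-cong (λ u → Σ-select (p u) (λ _ → g u)))

-- Counting vertices and edges

_⊆ᵇ_ : ∀ {n} → (Fin n → Bool) → (Fin n → Bool) → Set
X ⊆ᵇ Y = ∀ u → X u ≡ true → Y u ≡ true

if-mono-≤ : ∀ {b c} x → (b ≡ true → c ≡ true) → (if b then x else 0) ≤ (if c then x else 0)
if-mono-≤ {false} x _   = z≤n
if-mono-≤ {true}  x b⇒c rewrite b⇒c refl = ≤-refl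

if-∨-≤ : ∀ b c x → (if b ∨ c then x else 0) ≤ (if b then x else 0) + (if c then x else 0)
if-∨-≤ true  c x = m≤m+n x _
if-∨-≤ false c x = ≤-refl

∧-mono : ∀ {a a′ b b′} → (a ≡ true → a′ ≡ true) → (b ≡ true → b′ ≡ true) →
         a ∧ b ≡ true → a′ ∧ b′ ≡ true
∧-mono {true} {b = true} a⇒a′ b⇒b′ _ rewrite a⇒a′ refl | b⇒b′ refl = refl

0<⟦⟧⇒true : ∀ {b} → 0 < ⟦ b ⟧ → b ≡ true
0<⟦⟧⇒true {true} _ = refl

module _ {n : ℕ} where

  count-mono : {X Y : Fin n → Bool} → X ⊆ᵇ Y → count n X ≤ count n Y
  count-mono X⊆Y = Σ-mono-≤ (λ u → if-mono-≤ 1 (X⊆Y u))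

  count-∨ : (X Y : Fin n → Bool) → count n (λ u → X u ∨ Y u) ≤ count n X + count n Y
  count-∨ X Y = ≤-trans (Σ-mono-≤ (λ u → if-∨-≤ (X u) (Y u) 1))
                        (≤-reflexive (Σ-distrib-+ (λ u → ⟦ X u ⟧) (λ u → ⟦ Y u ⟧)))

0<count⇒∃ : ∀ {n} (X : Fin n → Bool) → 0 < count n X → ∃[ u ] X u ≡ true
0<count⇒∃ X 0<count with Σ-positive (λ u → ⟦ X u ⟧) 0<count
... | u , 0<⟦Xu⟧ = u , 0<⟦⟧⇒true 0<⟦Xu⟧

true⇒0<count : ∀ {n} (X : Fin n → Bool) {u} → X u ≡ true → 0 < count n X
true⇒0<count X {u} Xu = ≤-trans (≤-reflexive (cong ⟦_⟧ (sym Xu))) (term≤Σ (λ v → ⟦ X v ⟧) u)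

∣p∣≡count : ∀ {n} (S : Subset n) → ∣ S ∣ ≡ count n (lookup S)
∣p∣≡count S = trans (∣p∣≡∑ S) (sym (Σ≡∑ (λ u → ⟦ lookup S u ⟧)))
  where
  ∣p∣≡∑ : ∀ {n} (S : Subset n) → ∣ S ∣ ≡ ∑[ u < n ] ⟦ lookup S u ⟧
  ∣p∣≡∑ []          = refl
  ∣p∣≡∑ (true ∷ S)  = cong suc (∣p∣≡∑ S)
  ∣p∣≡∑ (false ∷ S) = ∣p∣≡∑ S

∣∁p∣≡count : ∀ {n} (S : Subset n) → ∣ ∁ S ∣ ≡ count n (not ∘ lookup S)
∣∁p∣≡count S = trans (∣p∣≡count (∁ S)) (Σ-cong (λ u → cong ⟦_⟧ (lookup-map u not S)))

-- Ordered pairs, so that δ w S is edges w (lookup S) (not ∘ lookup S) by definition.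
edges : ∀ {n} → Multigraph n → (Fin n → Bool) → (Fin n → Bool) → ℕ
edges {n} w X Y = Σ[ n ] (λ u → Σ[ n ] (λ v → if X u ∧ Y v then w u v else 0))

module _ {n : ℕ} (w : Multigraph n) where

  edges-mono : ∀ {X X′ Y Y′} → X ⊆ᵇ X′ → Y ⊆ᵇ Y′ → edges w X Y ≤ edges w X′ Y′
  edges-mono X⊆X′ Y⊆Y′ =
    Σ-mono-≤ λ u → Σ-mono-≤ λ v → if-mono-≤ (w u v) (∧-mono (X⊆X′ u) (Y⊆Y′ v))

  edges-∨ʳ : ∀ X Y Y′ → edges w X (λ v → Y v ∨ Y′ v) ≤ edges w X Y + edges w X Y′
  edges-∨ʳ X Y Y′ = begin
    edges w X (λ v → Y v ∨ Y′ v)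
      ≤⟨ Σ-mono-≤ (λ u → Σ-mono-≤ (λ v → term u v)) ⟩
    Σ[ n ] (λ u → Σ[ n ] (λ v → row Y u v + row Y′ u v))
      ≡⟨ Σ-cong (λ u → Σ-distrib-+ (row Y u) (row Y′ u)) ⟩
    Σ[ n ] (λ u → Σ[ n ] (row Y u) + Σ[ n ] (row Y′ u))
      ≡⟨ Σ-distrib-+ (λ u → Σ[ n ] (row Y u)) (λ u → Σ[ n ] (row Y′ u)) ⟩
    edges w X Y + edges w X Y′ ∎
    where
    open ≤-Reasoning
    row : (Fin n → Bool) → Fin n → Fin n → ℕ
    row Z u v = if X u ∧ Z v then w u v else 0
    term : ∀ u v → (if X u ∧ (Y v ∨ Y′ v) then w u v else 0) ≤ row Y u v + row Y′ u v
    term u v rewrite ∧-distribˡ-∨ (X u) (Y v) (Y′ v) = if-∨-≤ (X u ∧ Y v) (X u ∧ Y′ v) (w u v)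

  edges-fibresˡ : ∀ {m} (p : Fin n → Fin m) X Y →
                  Σ[ m ] (λ a → edges w (λ u → does (p u ≟ a) ∧ X u) Y) ≡ edges w X Y
  edges-fibresˡ {m} p X Y =
    trans (Σ-cong λ a → Σ-cong λ u → restrict (does (p u ≟ a)) u)
          (Σ-fibres p (λ u → Σ[ n ] (row u)))
    where
    row : Fin n → Fin n → ℕ
    row u v = if X u ∧ Y v then w u v else 0
    restrict : ∀ d u → Σ[ n ] (λ v → if (d ∧ X u) ∧ Y v then w u v else 0) ≡
                       (if d then Σ[ n ] (row u) else 0)
    restrict true  u = refl
    restrict false u = Σ-zero {n}

∈⇒≤foldr-⊔ : ∀ {x xs} → x ∈ xs → x ≤ foldr _⊔_ 0 xs
∈⇒≤foldr-⊔ (here refl) = m≤m⊔n _ _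
∈⇒≤foldr-⊔ (there x∈) = ≤-trans (∈⇒≤foldr-⊔ x∈) (m≤n⊔m _ _)

module _ {n : ℕ} (G : Graph n) where

  degree≤maxDegree : ∀ v → degree G v ≤ maxDegree G
  degree≤maxDegree v = ∈⇒≤foldr-⊔ (∈-map⁺ (degree G) (∈-allFin v))

  edge⇒0<edges : ∀ X Y {x y} → adj G x y ≡ true → X x ≡ true → Y y ≡ true →
                 0 < edges (asMultigraph G) X Y
  edge⇒0<edges X Y {x} {y} xy Xx Yy =
    ≤-trans (≤-reflexive one) (≤-trans (term≤Σ (row x) y) (term≤Σ (λ u → Σ[ n ] (row u)) x))
    where
    row : Fin n → Fin n → ℕ
    row u v = if X u ∧ Y v then ⟦ adj G u v ⟧ else 0
    one : 1 ≡ row x y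
    one rewrite Xx | Yy | xy = refl

  edges≤maxDegree*count : ∀ X Y → edges (asMultigraph G) X Y ≤ maxDegree G * count n Y
  edges≤maxDegree*count X Y = begin
    edges (asMultigraph G) X Y
      ≤⟨ edges-mono (asMultigraph G) {X} {λ _ → true} {Y} {Y} (λ _ _ → refl) (λ _ Yv → Yv) ⟩
    Σ[ n ] (λ u → Σ[ n ] (λ v → if Y v then ⟦ adj G u v ⟧ else 0))
      ≡⟨ Σ-comm (λ u v → if Y v then ⟦ adj G u v ⟧ else 0) ⟩
    Σ[ n ] (λ v → Σ[ n ] (λ u → if Y v then ⟦ adj G u v ⟧ else 0))
      ≡⟨ Σ-cong (λ v → if-then-Σ (Y v) (λ u → ⟦ adj G u v ⟧)) ⟨
    Σ[ n ] (λ v → if Y v then Σ[ n ] (λ u → ⟦ adj G u v ⟧) else 0)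
      ≡⟨ Σ-cong (λ v → cong (λ d → if Y v then d else 0) (Σ-cong (λ u → cong ⟦_⟧ (sym-adj u v)))) ⟩
    Σ[ n ] (λ v → if Y v then degree G v else 0)
      ≤⟨ Σ-mono-≤ (λ v → term (Y v) v) ⟩
    Σ[ n ] (λ v → maxDegree G * ⟦ Y v ⟧)
      ≡⟨ *-distribˡ-Σ (maxDegree G) (λ v → ⟦ Y v ⟧) ⟨
    maxDegree G * count n Y ∎
    where
    open ≤-Reasoning
    sym-adj = Graph.sym G
    term : ∀ b v → (if b then degree G v else 0) ≤ maxDegree G * ⟦ b ⟧
    term true  v = ≤-trans (degree≤maxDegree v) (≤-reflexive (sym (*-identityʳ _)))
    term false v = z≤n

  edges-contract : ∀ {m} (p : Fin n → Fin m) X Y →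
                   edges (contract G p) X Y ≡ edges (asMultigraph G) (X ∘ p) (Y ∘ p)
  edges-contract {m} p X Y = begin
    edges (contract G p) X Y
      ≡⟨ Σ-cong (λ a → Σ-cong (λ b → push (X a ∧ Y b) a b)) ⟩
    Σ[ m ] (λ a → Σ[ m ] (λ b → Σ[ n ] (λ u → Σ[ n ] (term a b u))))
      ≡⟨ Σ²-comm term ⟩
    Σ[ n ] (λ u → Σ[ n ] (λ v → Σ[ m ] (λ a → Σ[ m ] (λ b → term a b u v))))
      ≡⟨ Σ-cong (λ u → Σ-cong (λ v → select-both u v)) ⟩
    edges (asMultigraph G) (X ∘ p) (Y ∘ p) ∎
    where
    open ≡-Reasoning
    term : Fin m → Fin m → Fin n → Fin n → ℕ
    term a b u v = if X a ∧ Y b then ⟦ adj G u v ∧ does (p u ≟ a) ∧ does (p v ≟ b) ⟧ else 0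
    push : ∀ c a b → (if c then contract G p a b else 0) ≡
                     Σ[ n ] (λ u → Σ[ n ] (λ v →
                       if c then ⟦ adj G u v ∧ does (p u ≟ a) ∧ does (p v ≟ b) ⟧ else 0))
    push true  a b = refl
    push false a b = sym (trans (Σ-cong {n} (λ _ → Σ-zero {n})) (Σ-zero {n}))
    reorder : ∀ c d e x → (if x then ⟦ c ∧ d ∧ e ⟧ else 0) ≡
                          (if d then (if e then (if x then ⟦ c ⟧ else 0) else 0) else 0)
    reorder c true  true  x = cong (λ z → if x then ⟦ z ⟧ else 0) (∧-identityʳ c)
    reorder c true  false x = trans (cong (λ z → if x then ⟦ z ⟧ else 0) (∧-zeroʳ c)) (if-eta x)
    reorder c false e     x = trans (cong (λ z → if x then ⟦ z ⟧ else 0) (∧-zeroʳ c)) (if-eta x)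
    select-both : ∀ u v → Σ[ m ] (λ a → Σ[ m ] (λ b → term a b u v)) ≡
                          (if X (p u) ∧ Y (p v) then ⟦ adj G u v ⟧ else 0)
    select-both u v = begin
      Σ[ m ] (λ a → Σ[ m ] (λ b → term a b u v))
        ≡⟨ Σ-cong (λ a → Σ-cong (λ b →
             reorder (adj G u v) (does (p u ≟ a)) (does (p v ≟ b)) (X a ∧ Y b))) ⟩
      Σ[ m ] (λ a → Σ[ m ] (λ b → if does (p u ≟ a) then inner a b else 0))
        ≡⟨ Σ-cong (λ a → if-then-Σ (does (p u ≟ a)) (inner a)) ⟨
      Σ[ m ] (λ a → if does (p u ≟ a) then Σ[ m ] (inner a) else 0)
        ≡⟨ Σ-select (p u) (λ a → Σ[ m ] (inner a)) ⟩
      Σ[ m ] (inner (p u))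
        ≡⟨ Σ-select (p v) (λ b → if X (p u) ∧ Y b then ⟦ adj G u v ⟧ else 0) ⟩
      (if X (p u) ∧ Y (p v) then ⟦ adj G u v ⟧ else 0) ∎
      where
      inner : Fin m → Fin m → ℕ
      inner a b = if does (p v ≟ b) then (if X a ∧ Y b then ⟦ adj G u v ⟧ else 0) else 0

count-fibres : ∀ {n m} (p : Fin n → Fin m) (X : Fin n → Bool) →
               count n X ≡ Σ[ m ] (λ a → count n (λ u → does (p u ≟ a) ∧ X u))
count-fibres p X =
  sym (trans (Σ-cong λ a → Σ-cong λ u → if-∧ (does (p u ≟ a))) (Σ-fibres p (λ u → ⟦ X u ⟧)))

module _ {n m s : ℕ} (p : Fin n → Fin m) (part≤s : ∀ a → partSize p a ≤ s) where

  count-preimage≤ : (B : Fin m → Bool) → count n (B ∘ p) ≤ count m B * s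
  count-preimage≤ B = begin
    count n (B ∘ p)
      ≡⟨ Σ-fibres p (λ u → ⟦ B (p u) ⟧) ⟨
    Σ[ m ] (λ a → Σ[ n ] (λ u → if does (p u ≟ a) then ⟦ B (p u) ⟧ else 0))
      ≡⟨ Σ-cong (λ a → Σ-cong (λ u → term u a)) ⟩
    Σ[ m ] (λ a → Σ[ n ] (λ u → ⟦ B a ⟧ * ⟦ does (p u ≟ a) ⟧))
      ≡⟨ Σ-cong (λ a → *-distribˡ-Σ ⟦ B a ⟧ (λ u → ⟦ does (p u ≟ a) ⟧)) ⟨
    Σ[ m ] (λ a → ⟦ B a ⟧ * partSize p a)
      ≤⟨ Σ-mono-≤ (λ a → *-monoʳ-≤ ⟦ B a ⟧ (part≤s a)) ⟩
    Σ[ m ] (λ a → ⟦ B a ⟧ * s)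
      ≡⟨ *-distribʳ-Σ s (λ a → ⟦ B a ⟧) ⟨
    count m B * s ∎
    where
    open ≤-Reasoning
    term : ∀ u a → (if does (p u ≟ a) then ⟦ B (p u) ⟧ else 0) ≡ ⟦ B a ⟧ * ⟦ does (p u ≟ a) ⟧
    term u a with p u ≟ a
    ... | yes refl = sym (*-identityʳ _)
    ... | no _     = sym (*-zeroʳ ⟦ B a ⟧)

-- The parts lying inside a cut

walk-head : ∀ {n} {G : Graph n} {U : Fin n → Set} {u v} → WalkIn G U u v → U u
walk-head (here Uu)     = Uu
walk-head (step Uu _ _) = Uu

walk-crossing : ∀ {n} {G : Graph n} {U : Fin n → Set} (X : Fin n → Bool) {u v} →
                WalkIn G U u v → X u ≡ true → X v ≡ false →
                ∃[ x ] ∃[ y ] U x × U y × adj G x y ≡ true × X x ≡ true × X y ≡ false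
walk-crossing X (here _) Xu Xv = contradiction (trans (sym Xu) Xv) λ ()
walk-crossing X (step {v = w} Uu uw walk) Xu Xv with X w in Xw
... | true  = walk-crossing X walk Xw Xv
... | false = _ , w , Uu , walk-head walk , uw , Xu , Xw

-- T is the set of parts lying inside the cut S, covered is their union W and stray is S ∖ W.
module InsideParts {n m : ℕ} (G : Graph n) (p : Fin n → Fin m) (S₀ : Subset n) where

  S : Fin n → Bool
  S = lookup S₀

  outsider? : ∀ a → Dec (∃[ v ] p v ≡ a × S v ≡ false)
  outsider? a = any? (λ v → (p v ≟ a) ×-dec (S v ≟ᵇ false))

  inside : Fin m → Bool
  inside a = not (does (outsider? a))

  outsider : ∀ {a} → inside a ≡ false → ∃[ v ] p v ≡ a × S v ≡ false
  outsider {a} _ with outsider? a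
  ... | yes out = out

  covered : Fin n → Bool
  covered = inside ∘ p

  covered⊆S : covered ⊆ᵇ S
  covered⊆S u _ with outsider? (p u) | S u in Su
  ... | no ¬out | false = contradiction (u , refl , Su) ¬out
  ... | no _    | true  = refl

  stray : Fin n → Bool
  stray u = S u ∧ not (covered u)

  T : Subset m
  T = Vec.tabulate inside

  ∣T∣≡count : ∣ T ∣ ≡ count m inside
  ∣T∣≡count = trans (∣p∣≡count T) (Σ-cong (λ a → cong ⟦_⟧ (lookup∘tabulate inside a)))

  ∣∁T∣≡count : ∣ ∁ T ∣ ≡ count m (not ∘ inside)
  ∣∁T∣≡count = trans (∣∁p∣≡count T) (Σ-cong (λ a → cong (⟦_⟧ ∘ not) (lookup∘tabulate inside a)))

  module _ {s : ℕ} (part≤s : ∀ a → partSize p a ≤ s) where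

    ∣S₀∣≤ : ∣ S₀ ∣ ≤ ∣ T ∣ * s + count n stray
    ∣S₀∣≤ = begin
      ∣ S₀ ∣                              ≡⟨ ∣p∣≡count S₀ ⟩
      count n S                           ≤⟨ count-mono S⊆covered∪stray ⟩
      count n (λ u → covered u ∨ stray u) ≤⟨ count-∨ covered stray ⟩
      count n covered + count n stray     ≤⟨ +-monoˡ-≤ _ (count-preimage≤ p part≤s inside) ⟩
      count m inside * s + count n stray  ≡⟨ cong (λ t → t * s + count n stray) ∣T∣≡count ⟨
      ∣ T ∣ * s + count n stray           ∎
      where
      open ≤-Reasoning
      S⊆covered∪stray : S ⊆ᵇ (λ u → covered u ∨ stray u)
      S⊆covered∪stray u Su with covered u
      ... | true  = refl
      ... | false rewrite Su = refl

    ∣∁S₀∣≤ : ∣ ∁ S₀ ∣ ≤ ∣ ∁ T ∣ * s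
    ∣∁S₀∣≤ = begin
      ∣ ∁ S₀ ∣                  ≡⟨ ∣∁p∣≡count S₀ ⟩
      count n (not ∘ S)         ≤⟨ count-mono ∁S⊆∁covered ⟩
      count n (not ∘ covered)   ≤⟨ count-preimage≤ p part≤s (not ∘ inside) ⟩
      count m (not ∘ inside) * s ≡⟨ cong (_* s) ∣∁T∣≡count ⟨
      ∣ ∁ T ∣ * s               ∎
      where
      open ≤-Reasoning
      ∁S⊆∁covered : (not ∘ S) ⊆ᵇ (not ∘ covered)
      ∁S⊆∁covered u ¬Su with covered u in cu
      ... | false = refl
      ... | true  = subst (λ b → not b ≡ true) (covered⊆S u cu) ¬Su

    stray≤s*δ : (∀ a → InducedConnected G (λ u → p u ≡ a)) →
                count n stray ≤ s * δ (asMultigraph G) S₀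
    stray≤s*δ connected = begin
      count n stray
        ≡⟨ count-fibres p stray ⟩
      Σ[ m ] (λ a → count n (stray∩ a))
        ≤⟨ Σ-mono-≤ (λ a → ≤-*-positive (strays≤s a) (strays⇒crossing a)) ⟩
      Σ[ m ] (λ a → s * edges G′ (S∩ a) (not ∘ S))
        ≡⟨ *-distribˡ-Σ s (λ a → edges G′ (S∩ a) (not ∘ S)) ⟨
      s * Σ[ m ] (λ a → edges G′ (S∩ a) (not ∘ S))
        ≡⟨ cong (s *_) (edges-fibresˡ G′ p S (not ∘ S)) ⟩
      s * δ G′ S₀ ∎
      where
      open ≤-Reasoning
      G′ = asMultigraph G
      stray∩ S∩ : Fin m → Fin n → Bool
      stray∩ a u = does (p u ≟ a) ∧ stray u
      S∩     a u = does (p u ≟ a) ∧ S u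
      strays≤s : ∀ a → count n (stray∩ a) ≤ s
      strays≤s a = ≤-trans (count-mono (λ u → ∧-conicalˡ (does (p u ≟ a)) (stray u))) (part≤s a)
      -- The part of a stray vertex u also has a vertex v outside S, and a walk from u to v
      -- inside the part crosses the cut.
      strays⇒crossing : ∀ a → 0 < count n (stray∩ a) → 0 < edges G′ (S∩ a) (not ∘ S)
      strays⇒crossing a 0<c with 0<count⇒∃ (stray∩ a) 0<c
      ... | u , _ with p u ≟ a | S u in Su | covered u in cu
      ... | yes refl | true | false with outsider cu
      ...   | v , pv , Sv with walk-crossing S (connected (p u) u v refl pv) Su Sv
      ...     | x , y , px , py , xy , Sx , Sy =
                edge⇒0<edges G (S∩ (p u)) (not ∘ S) xy
                  (cong₂ _∧_ (dec-true (p x ≟ p u) px) Sx) (cong not Sy)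
      ≤-*-positive : ∀ {c e} → c ≤ s → (0 < c → 0 < e) → c ≤ s * e
      ≤-*-positive {zero}  _   _ = z≤n
      ≤-*-positive {suc _} c≤s pos =
        ≤-trans c≤s (≤-trans (≤-reflexive (sym (*-identityʳ s))) (*-monoʳ-≤ s (pos (s≤s z≤n))))

  δ-contract≤ : δ (contract G p) T ≤ δ (asMultigraph G) S₀ + maxDegree G * count n stray
  δ-contract≤ = begin
    δ (contract G p) T
      ≡⟨ edges-contract G p (lookup T) (not ∘ lookup T) ⟩
    edges G′ (lookup T ∘ p) (not ∘ lookup T ∘ p)
      ≤⟨ edges-mono G′ inside⊆S ∁inside⊆∁S∪stray ⟩
    edges G′ S (λ v → not (S v) ∨ stray v)
      ≤⟨ edges-∨ʳ G′ S (not ∘ S) stray ⟩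
    δ G′ S₀ + edges G′ S stray
      ≤⟨ +-monoʳ-≤ _ (edges≤maxDegree*count G S stray) ⟩
    δ G′ S₀ + maxDegree G * count n stray ∎
    where
    open ≤-Reasoning
    G′ = asMultigraph G
    inside⊆S : (lookup T ∘ p) ⊆ᵇ S
    inside⊆S u h = covered⊆S u (trans (sym (lookup∘tabulate inside (p u))) h)
    ∁inside⊆∁S∪stray : (not ∘ lookup T ∘ p) ⊆ᵇ (λ v → not (S v) ∨ stray v)
    ∁inside⊆∁S∪stray v h with S v
    ... | false = refl
    ... | true  = trans (cong not (sym (lookup∘tabulate inside (p v)))) h

-- Expansion

minimum-≤ : ∀ {x} xs → x ∈ xs → minimum xs ≤ℚ x
minimum-≤ (x ∷ [])     (here refl) = ℚₚ.≤-refl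
minimum-≤ (x ∷ y ∷ ys) (here refl) = ℚₚ.p⊓q≤p x (minimum (y ∷ ys))
minimum-≤ (x ∷ y ∷ ys) (there x∈)  =
  ℚₚ.≤-trans (ℚₚ.p⊓q≤q x (minimum (y ∷ ys))) (minimum-≤ (y ∷ ys) x∈)

minimum-∈ : ∀ xs {x} → x ∈ xs → minimum xs ∈ xs
minimum-∈ (x ∷ xs) _ = minimum∷-∈ x xs
  where
  minimum∷-∈ : ∀ x xs → minimum (x ∷ xs) ∈ x ∷ xs
  minimum∷-∈ x []       = here refl
  minimum∷-∈ x (y ∷ ys) =
    [ here , (λ x⊓min≡min → there (subst (_∈ y ∷ ys) (sym x⊓min≡min) (minimum∷-∈ y ys))) ]′
      (ℚₚ.⊓-sel x (minimum (y ∷ ys)))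

∈-subsets : ∀ {m} (S : Subset m) → S ∈ subsets m
∈-subsets []          = here refl
∈-subsets (true ∷ S)  = ∈-++⁺ˡ (∈-map⁺ (true ∷_) (∈-subsets S))
∈-subsets (false ∷ S) = ∈-++⁺ʳ (map (true ∷_) (subsets _)) (∈-map⁺ (false ∷_) (∈-subsets S))

∈-properSubsets⇔ : ∀ {m} {S : Subset m} → S ∈ properSubsets m ⇔ 0 < ∣ S ∣ ⊓ ∣ ∁ S ∣
∈-properSubsets⇔ {m} {S} = mk⇔ to from
  where
  proper? = λ (S : Subset m) → (0 <? ∣ S ∣) ×-dec (∣ S ∣ <? m)
  ∣∁S∣≡ : ∣ ∁ S ∣ ≡ m ∸ ∣ S ∣
  ∣∁S∣≡ = ∣∁p∣≡n∸∣p∣ S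
  to : S ∈ properSubsets m → 0 < ∣ S ∣ ⊓ ∣ ∁ S ∣
  to S∈ with ∈-filter⁻ proper? {xs = subsets m} S∈
  ... | _ , 0<∣S∣ , ∣S∣<m = ⊓-glb 0<∣S∣ (subst (0 <_) (sym ∣∁S∣≡) (m<n⇒0<n∸m ∣S∣<m))
  from : 0 < ∣ S ∣ ⊓ ∣ ∁ S ∣ → S ∈ properSubsets m
  from 0<k = ∈-filter⁺ proper? (∈-subsets S) (0<∣S∣ , ∣S∣<m)
    where
    0<∣S∣ = ≤-trans 0<k (m⊓n≤m _ _)
    ∣S∣<m : ∣ S ∣ < m
    ∣S∣<m = subst (∣ S ∣ <_) (trans (cong (∣ S ∣ +_) ∣∁S∣≡) (m+[n∸m]≡n (∣p∣≤n S)))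
                  (m<m+n ∣ S ∣ (≤-trans 0<k (m⊓n≤n _ _)))

∃-properSubset : ∀ {m} → 2 ≤ m → ∃[ S ] S ∈ properSubsets m
∃-properSubset {suc zero}    (s≤s ())
∃-properSubset {suc (suc m)} _ =
  ⁅ zero ⁆ , Equivalence.from ∈-properSubsets⇔ (s≤s z≤n)

module _ {m : ℕ} (w : Multigraph m) where

  ratio : Subset m → ℚ
  ratio S = δ w S ÷ℕ (∣ S ∣ ⊓ ∣ ∁ S ∣)

  expansion≤ratio : ∀ {S} → S ∈ properSubsets m → expansion w ≤ℚ ratio S
  expansion≤ratio S∈ = minimum-≤ _ (∈-map⁺ ratio S∈)

  expansion-attained : 2 ≤ m → ∃[ S ] S ∈ properSubsets m × expansion w ≡ ratio S
  expansion-attained 2≤m with ∃-properSubset 2≤m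
  ... | S , S∈ = ∈-map⁻ ratio (minimum-∈ _ (∈-map⁺ ratio S∈))

toℚᵘ-÷ℕ : ∀ a k → toℚᵘ (a ÷ℕ suc k) ≃ᵘ mkℚᵘ (ℤ.+ a) k
toℚᵘ-÷ℕ a k = ℚₚ.toℚᵘ-fromℚᵘ (mkℚᵘ (ℤ.+ a) k)

÷ℕ-≤⇔ : ∀ a k c d .{{_ : NonZero k}} .{{_ : NonZero d}} → (a ÷ℕ k ≤ℚ c ÷ℕ d) ⇔ (a * d ≤ c * k)
÷ℕ-≤⇔ a (suc k) c (suc d) = mk⇔ to from
  where
  to : a ÷ℕ suc k ≤ℚ c ÷ℕ suc d → a * suc d ≤ c * suc k
  to x≤y with ℚᵘₚ.≤-respˡ-≃ (toℚᵘ-÷ℕ a k) (ℚᵘₚ.≤-respʳ-≃ (toℚᵘ-÷ℕ c d) (ℚₚ.toℚᵘ-mono-≤ x≤y))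
  ... | *≤* ad≤ck =
    ℤₚ.drop‿+≤+ (subst₂ ℤ._≤_ (sym (ℤₚ.pos-* a (suc d))) (sym (ℤₚ.pos-* c (suc k))) ad≤ck)
  from : a * suc d ≤ c * suc k → a ÷ℕ suc k ≤ℚ c ÷ℕ suc d
  from ad≤ck = ℚₚ.toℚᵘ-cancel-≤
    (ℚᵘₚ.≤-respˡ-≃ (ℚᵘₚ.≃-sym (toℚᵘ-÷ℕ a k)) (ℚᵘₚ.≤-respʳ-≃ (ℚᵘₚ.≃-sym (toℚᵘ-÷ℕ c d))
      (*≤* (subst₂ ℤ._≤_ (ℤₚ.pos-* a (suc d)) (ℤₚ.pos-* c (suc k)) (ℤ.+≤+ ad≤ck)))))

*-÷ℕ : ∀ x a k .{{_ : NonZero k}} → (ℤ.+ x / 1) *ℚ (a ÷ℕ k) ≡ (x * a) ÷ℕ k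
*-÷ℕ x a (suc k) = ℚₚ.toℚᵘ-injective (begin
  toℚᵘ ((ℤ.+ x / 1) *ℚ (a ÷ℕ suc k))         ≈⟨ ℚₚ.toℚᵘ-homo-* (ℤ.+ x / 1) (a ÷ℕ suc k) ⟩
  toℚᵘ (ℤ.+ x / 1) ℚᵘ.* toℚᵘ (a ÷ℕ suc k)    ≈⟨ ℚᵘₚ.*-cong (toℚᵘ-÷ℕ x 0) (toℚᵘ-÷ℕ a k) ⟩
  mkℚᵘ (ℤ.+ x) 0 ℚᵘ.* mkℚᵘ (ℤ.+ a) k         ≈⟨ numerators ⟩
  mkℚᵘ (ℤ.+ (x * a)) k                       ≈⟨ toℚᵘ-÷ℕ (x * a) k ⟨
  toℚᵘ ((x * a) ÷ℕ suc k)                    ∎)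
  where
  open ℚᵘₚ.≃-Reasoning
  numerators : mkℚᵘ (ℤ.+ x) 0 ℚᵘ.* mkℚᵘ (ℤ.+ a) k ≃ᵘ mkℚᵘ (ℤ.+ (x * a)) k
  numerators = *≡* (cong₂ ℤ._*_ (sym (ℤₚ.pos-* x a))
                                (cong (λ z → ℤ.+ suc (pred z)) (sym (*-identityˡ (suc k)))))

÷ℕ≤1÷ℕ⇒*≤ : ∀ a k d .{{_ : NonZero k}} .{{_ : NonZero d}} → a ÷ℕ k ≤ℚ 1 ÷ℕ d → d * a ≤ k
÷ℕ≤1÷ℕ⇒*≤ a k d a/k≤1/d =
  subst₂ _≤_ (*-comm a d) (*-identityˡ k) (Equivalence.to (÷ℕ-≤⇔ a k 1 d) a/k≤1/d)

min-side-bound : ∀ s {δ k t t′ z} → 2 * s * δ ≤ k → k ≤ t * s + z → k ≤ t′ * s → z ≤ s * δ →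
                 k ≤ 2 * s * (t ⊓ t′)
min-side-bound s {δ} {k} {t} {t′} {z} 2sδ≤k k≤ts+z k≤t′s z≤sδ =
  subst (k ≤_) (sym (*-distribˡ-⊓ (2 * s) t t′)) (⊓-glb k≤2st k≤2st′)
  where
  open ≤-Reasoning
  k≤2st : k ≤ 2 * s * t
  k≤2st = +-cancelʳ-≤ k k (2 * s * t) (begin
    k + k                         ≤⟨ +-mono-≤ k≤ts+z k≤ts+z ⟩
    (t * s + z) + (t * s + z)     ≤⟨ +-mono-≤ (+-monoʳ-≤ (t * s) z≤sδ) (+-monoʳ-≤ (t * s) z≤sδ) ⟩
    (t * s + s * δ) + (t * s + s * δ) ≡⟨ rearrange t s δ ⟩
    2 * s * t + 2 * s * δ         ≤⟨ +-monoʳ-≤ (2 * s * t) 2sδ≤k ⟩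
    2 * s * t + k                 ∎)
    where
    rearrange : ∀ t s δ → (t * s + s * δ) + (t * s + s * δ) ≡ 2 * s * t + 2 * s * δ
    rearrange = solve-∀
  k≤2st′ : k ≤ 2 * s * t′
  k≤2st′ = begin
    k          ≤⟨ k≤t′s ⟩
    t′ * s     ≡⟨ *-comm t′ s ⟩
    s * t′     ≤⟨ *-monoˡ-≤ t′ (m≤n*m s 2) ⟩
    2 * s * t′ ∎

contracted-cut-bound : ∀ s Δ {dP δ z c} → dP ≤ δ + Δ * z → z ≤ s * δ → δ ≤ Δ * c → 0 < s →
                       dP ≤ 2 * s * Δ * δ
contracted-cut-bound s zero {δ = δ} dP≤ _ δ≤0 _ =
  ≤-trans dP≤ (≤-trans (≤-reflexive (+-identityʳ δ)) (≤-trans δ≤0 z≤n))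
contracted-cut-bound s@(suc _) Δ@(suc _) {dP} {δ} {z} dP≤ z≤sδ _ _ = begin
  dP                    ≤⟨ dP≤ ⟩
  δ + Δ * z             ≤⟨ +-mono-≤ (m≤n*m δ (s * Δ)) (*-monoʳ-≤ Δ z≤sδ) ⟩
  s * Δ * δ + Δ * (s * δ) ≡⟨ rearrange s Δ δ ⟩
  2 * s * Δ * δ         ∎
  where
  open ≤-Reasoning
  rearrange : ∀ s Δ δ → s * Δ * δ + Δ * (s * δ) ≡ 2 * s * Δ * δ
  rearrange = solve-∀

cross-multiplied-bound : ∀ s Δ {dP δ k k′} → dP ≤ 2 * s * Δ * δ → k ≤ 2 * s * k′ →
                         dP * k ≤ 4 * s ^ 2 * Δ * δ * k′
cross-multiplied-bound s Δ {dP} {δ} {k} {k′} dP≤ k≤ =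
  ≤-trans (*-mono-≤ dP≤ k≤) (≤-reflexive (rearrange s Δ δ k′))
  where
  -- s ^ 2 is written as its unfolding s * (s * 1), as the ring solver does not handle _^_.
  rearrange : ∀ s Δ δ k′ → 2 * s * Δ * δ * (2 * s * k′) ≡ 4 * (s * (s * 1)) * Δ * δ * k′
  rearrange = solve-∀

lemma8p8 : (n m s : ℕ) → 2 ≤ n → (G : Graph n) → (p : Fin n → Fin m) →
    Surjective p →
    (∀ (a : Fin m) → InducedConnected G (λ u → p u ≡ a)) →
    (∀ (a : Fin m) → partSize p a ≤ s) →
    expansion (asMultigraph G) ≤ℚ (1 ÷ℕ (2 * s)) →
    expansion (contract G p)
      ≤ℚ ((ℤ.+ (4 * s ^ 2 * maxDegree G) / 1) *ℚ expansion (asMultigraph G))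
lemma8p8 (suc _) m s 2≤n G p _ connected part≤s h≤1/2s with expansion-attained (asMultigraph G) 2≤n
... | S₀ , S₀-proper , h≡ratio = begin
  expansion (contract G p)    ≤⟨ expansion≤ratio (contract G p) {T} T-proper ⟩
  δ (contract G p) T ÷ℕ k′     ≤⟨ Equivalence.from (÷ℕ-≤⇔ _ k′ _ k) cross ⟩
  (X * δ G′ S₀) ÷ℕ k           ≡⟨ *-÷ℕ X (δ G′ S₀) k ⟨
  (ℤ.+ X / 1) *ℚ ratio G′ S₀   ≡⟨ cong ((ℤ.+ X / 1) *ℚ_) h≡ratio ⟨
  (ℤ.+ X / 1) *ℚ expansion G′  ∎
  where
  open ℚₚ.≤-Reasoning
  open InsideParts G p S₀
  G′ = asMultigraph G
  X = 4 * s ^ 2 * maxDegree G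
  k = ∣ S₀ ∣ ⊓ ∣ ∁ S₀ ∣
  k′ = ∣ T ∣ ⊓ ∣ ∁ T ∣
  0<s : 0 < s
  0<s = ≤-trans (true⇒0<count (λ u → does (p u ≟ p zero)) (dec-true (p zero ≟ p zero) refl))
                (part≤s (p zero))
  instance
    k≢0 : NonZero k
    k≢0 = >-nonZero (Equivalence.to ∈-properSubsets⇔ S₀-proper)
    2s≢0 : NonZero (2 * s)
    2s≢0 = >-nonZero (≤-trans 0<s (m≤n*m s 2))
  stray≤ = stray≤s*δ part≤s connected
  k≤2sk′ : k ≤ 2 * s * k′
  k≤2sk′ = min-side-bound s (÷ℕ≤1÷ℕ⇒*≤ _ k (2 * s) (subst (_≤ℚ 1 ÷ℕ (2 * s)) h≡ratio h≤1/2s))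
    (≤-trans (m⊓n≤m _ _) (∣S₀∣≤ part≤s)) (≤-trans (m⊓n≤n _ _) (∣∁S₀∣≤ part≤s)) stray≤
  instance
    k′≢0 : NonZero k′
    k′≢0 = m*n≢0⇒n≢0 (2 * s) {{>-nonZero (≤-trans (>-nonZero⁻¹ k) k≤2sk′)}}
  T-proper = Equivalence.from ∈-properSubsets⇔ (>-nonZero⁻¹ k′)
  cross : δ (contract G p) T * k ≤ X * δ G′ S₀ * k′
  cross = cross-multiplied-bound s (maxDegree G)
    (contracted-cut-bound s (maxDegree G) δ-contract≤ stray≤ (edges≤maxDegree*count G S (not ∘ S)) 0<s)
    k≤2sk′
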